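{- Let the polynomials $p_k(y)$, $k\ge1$, be defined by $p_1(y)=2y-3$ and $p_{k+1}(y)=4y\,p_k'(y)+(5-4y)\,p_k(y)$. For an integer $r\ge2$ let $$W_r(y)=\det\big[p_{i+j-1}(y)\big]_{i,j=1}^{r},$$ let $\mu(r)=r(r-1)/2$, $\epsilon_r=(-1)^{\mu(r)}$, and write $\epsilon_rW_r(y)=\sum_{j=0}^{r^2}\gamma(j,r)y^j$. Then $\gamma(j,r)=0$ for $j=0,1,\ldots,\mu(r)-1$. -}

module Defs where

open import Data.Nat using (ℕ; zero; suc; _∸_) renaming (_*_ to _*ℕ_; _/_ to _/ℕ_)
open import Data.Integer using (ℤ; +_; -_; _+_; _*_; -[1+_])
open import Data.List using (List; []; _∷_)
open import Data.Fin using (Fin; zero; suc; punchIn)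

-- Polynomials over ℤ as coefficient lists, lowest degree first:
-- a₀ ∷ a₁ ∷ … represents a₀ + a₁ y + a₂ y² + …
Poly : Set
Poly = List ℤ

infixl 6 _⊕_
infixl 7 _⊗_

_⊕_ : Poly → Poly → Poly
[] ⊕ q = q
(a ∷ p) ⊕ [] = a ∷ p
(a ∷ p) ⊕ (b ∷ q) = (a + b) ∷ (p ⊕ q)

scale : ℤ → Poly → Poly
scale c [] = []
scale c (a ∷ p) = (c * a) ∷ scale c p

_⊗_ : Poly → Poly → Poly
[] ⊗ q = []
(a ∷ p) ⊗ q = scale a q ⊕ (+ 0 ∷ (p ⊗ q))

derivAux : ℕ → Poly → Poly
derivAux k [] = []
derivAux k (b ∷ p) = (+ k * b) ∷ derivAux (suc k) p

deriv : Poly → Poly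
deriv [] = []
deriv (a ∷ p) = derivAux 1 p

coeff : Poly → ℕ → ℤ
coeff [] j = + 0
coeff (a ∷ p) zero = a
coeff (a ∷ p) (suc j) = coeff p j

-- P k = p_{k+1};  p_1(y) = 2y - 3,
-- p_{k+1}(y) = 4y p_k'(y) + (5 - 4y) p_k(y)
P : ℕ → Poly
P zero = - (+ 3) ∷ + 2 ∷ []
P (suc k) = ((+ 0 ∷ + 4 ∷ []) ⊗ deriv (P k)) ⊕ ((+ 5 ∷ - (+ 4) ∷ []) ⊗ P k)

negOnePow : ℕ → ℤ
negOnePow zero = + 1
negOnePow (suc n) = - negOnePow n

sumFin : (n : ℕ) → (Fin n → Poly) → Poly
sumFin zero f = []
sumFin (suc n) f = f zero ⊕ sumFin n (λ i → f (suc i))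

det : (n : ℕ) → (Fin n → Fin n → Poly) → Poly
det zero M = + 1 ∷ []
det (suc n) M =
  sumFin (suc n) (λ j →
    scale (negOnePow (Data.Fin.toℕ j))
      (M zero j ⊗ det n (λ a b → M (suc a) (punchIn j b))))

-- W_r(y) = det [ p_{i+j-1}(y) ]_{i,j=1..r}; with 0-based i,j this is p_{i+j+1} = P (i+j)
W : (r : ℕ) → Poly
W r = det r (λ i j → P (Data.Fin.toℕ i Data.Nat.+ Data.Fin.toℕ j))

μ : ℕ → ℕ
μ r = (r *ℕ (r ∸ 1)) /ℕ 2

ε : ℕ → ℤ
ε r = negOnePow (μ r)

-- Write L for the operator p ↦ 4y p' + (5 − 4y) p, so that p_{k+1} = L p_k and the
-- row i of [p_{i+j-1}] is L^i applied to the first row. On coefficients L is lower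
-- triangular, (L p)_j = (4j + 5) p_j − 4 p_{j−1}, so (L − (4m + 5)) raises the order
-- of vanishing at y = 0 from m to m + 1. Subtracting suitable multiples of earlier rows
-- replaces row i by (L − 4(i−1) − 5) ⋯ (L − 5) applied to the first row without changing
-- the determinant; that row is divisible by y^i, and every term of the Laplace expansion
-- is then divisible by y^(0 + 1 + ⋯ + (r−1)) = y^μ(r).

module Submission where

open import Defs
open import Level using (0ℓ)
open import Data.Nat as ℕ using (ℕ; zero; suc; _≤_; _<_; z≤n; s≤s; _∸_; _⊓_)
import Data.Nat.Properties as ℕP
open import Data.Nat.DivMod using (m*n/n≡m)
open import Data.Nat.GeneralisedArithmetic using (iterate)
import Data.Nat.Tactic.RingSolver as ℕSolver
open import Data.Integer using (ℤ; +_; -_; _+_; _-_; _*_)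
import Data.Integer.Properties as ℤP
open import Data.Integer.Tactic.RingSolver using (solve-∀)
open import Data.List using ([]; _∷_)
open import Data.Fin using (Fin; zero; suc; punchIn; toℕ; lift)
open import Data.Fin.Properties using (toℕ<n)
open import Data.Product using (_,_)
open import Data.Sum using (_⊎_; inj₁; inj₂)
open import Function using (_∘_)
open import Algebra.Bundles using (CommutativeMonoid; CommutativeSemigroup)
open import Algebra.Definitions.RawMonoid ℕ.+-0-rawMonoid using (sum)
import Algebra.Properties.CommutativeSemigroup as CommutativeSemigroupProperties
open import Relation.Binary.Bundles using (Setoid)
open import Relation.Binary.Structures using (IsEquivalence)
import Relation.Binary.Reasoning.Setoid as SetoidReasoning
open import Relation.Binary.PropositionalEquality
  using (_≡_; _≗_; refl; sym; trans; cong; cong₂; subst; module ≡-Reasoning)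

-- Polynomial arithmetic up to coefficientwise equality

infix 4 _≈_

record _≈_ (p q : Poly) : Set where
  constructor mk≈
  field coeff-≡ : ∀ j → coeff p j ≡ coeff q j

open _≈_

≈-refl : ∀ {p} → p ≈ p
≈-refl = mk≈ λ _ → refl

≈-sym : ∀ {p q} → p ≈ q → q ≈ p
≈-sym p≈q = mk≈ λ j → sym (coeff-≡ p≈q j)

≈-trans : ∀ {p q r} → p ≈ q → q ≈ r → p ≈ r
≈-trans p≈q q≈r = mk≈ λ j → trans (coeff-≡ p≈q j) (coeff-≡ q≈r j)

≡⇒≈ : ∀ {p q} → p ≡ q → p ≈ q
≡⇒≈ refl = ≈-refl

≈-isEquivalence : IsEquivalence _≈_
≈-isEquivalence = record { refl = ≈-refl ; sym = ≈-sym ; trans = ≈-trans }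

≈-setoid : Setoid 0ℓ 0ℓ
≈-setoid = record { isEquivalence = ≈-isEquivalence }

module ≈-Reasoning = SetoidReasoning ≈-setoid

∷-cong : ∀ {a b p q} → a ≡ b → p ≈ q → a ∷ p ≈ b ∷ q
∷-cong a≡b p≈q = mk≈ λ { zero → a≡b ; (suc j) → coeff-≡ p≈q j }

0∷[]≈[] : + 0 ∷ [] ≈ []
0∷[]≈[] = mk≈ λ { zero → refl ; (suc j) → refl }

coeff-⊕ : ∀ p q j → coeff (p ⊕ q) j ≡ coeff p j + coeff q j
coeff-⊕ [] q j = sym (ℤP.+-identityˡ (coeff q j))
coeff-⊕ (a ∷ p) [] zero = sym (ℤP.+-identityʳ a)
coeff-⊕ (a ∷ p) [] (suc j) = sym (ℤP.+-identityʳ (coeff p j))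
coeff-⊕ (a ∷ p) (b ∷ q) zero = refl
coeff-⊕ (a ∷ p) (b ∷ q) (suc j) = coeff-⊕ p q j

coeff-scale : ∀ c p j → coeff (scale c p) j ≡ c * coeff p j
coeff-scale c [] j = sym (ℤP.*-zeroʳ c)
coeff-scale c (a ∷ p) zero = refl
coeff-scale c (a ∷ p) (suc j) = coeff-scale c p j

coeff-⊕-scale : ∀ c p q j → coeff (p ⊕ scale c q) j ≡ coeff p j + c * coeff q j
coeff-⊕-scale c p q j = trans (coeff-⊕ p (scale c q) j) (cong (λ z → coeff p j + z) (coeff-scale c q j))

⊕-cong : ∀ {p p′ q q′} → p ≈ p′ → q ≈ q′ → p ⊕ q ≈ p′ ⊕ q′
⊕-cong {p} {p′} {q} {q′} p≈p′ q≈q′ = mk≈ λ j →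
  trans (coeff-⊕ p q j) (trans (cong₂ _+_ (coeff-≡ p≈p′ j) (coeff-≡ q≈q′ j)) (sym (coeff-⊕ p′ q′ j)))

⊕-comm : ∀ p q → p ⊕ q ≈ q ⊕ p
⊕-comm p q = mk≈ λ j →
  trans (coeff-⊕ p q j) (trans (ℤP.+-comm (coeff p j) _) (sym (coeff-⊕ q p j)))

⊕-assoc : ∀ p q r → (p ⊕ q) ⊕ r ≈ p ⊕ (q ⊕ r)
⊕-assoc p q r = mk≈ λ j → begin
  coeff ((p ⊕ q) ⊕ r) j
    ≡⟨ trans (coeff-⊕ (p ⊕ q) r j) (cong (_+ coeff r j) (coeff-⊕ p q j)) ⟩
  coeff p j + coeff q j + coeff r j
    ≡⟨ ℤP.+-assoc (coeff p j) _ _ ⟩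
  coeff p j + (coeff q j + coeff r j)
    ≡⟨ sym (trans (coeff-⊕ p (q ⊕ r) j) (cong (λ z → coeff p j + z) (coeff-⊕ q r j))) ⟩
  coeff (p ⊕ (q ⊕ r)) j ∎
  where open ≡-Reasoning

⊕-identityʳ : ∀ p → p ⊕ [] ≈ p
⊕-identityʳ p = mk≈ λ j → trans (coeff-⊕ p [] j) (ℤP.+-identityʳ _)

⊕-commutativeMonoid : CommutativeMonoid 0ℓ 0ℓ
⊕-commutativeMonoid = record
  { _≈_ = _≈_
  ; _∙_ = _⊕_
  ; ε = []
  ; isCommutativeMonoid = record
    { isMonoid = record
      { isSemigroup = record
        { isMagma = record { isEquivalence = ≈-isEquivalence ; ∙-cong = ⊕-cong }
        ; assoc = ⊕-assoc
        }
      ; identity = (λ _ → ≈-refl) , ⊕-identityʳ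
      }
    ; comm = ⊕-comm
    }
  }

open CommutativeSemigroupProperties (CommutativeMonoid.commutativeSemigroup ⊕-commutativeMonoid)
  using () renaming (interchange to ⊕-interchange)

scale-cong : ∀ c {p q} → p ≈ q → scale c p ≈ scale c q
scale-cong c {p} {q} p≈q = mk≈ λ j →
  trans (coeff-scale c p j) (trans (cong (c *_) (coeff-≡ p≈q j)) (sym (coeff-scale c q j)))

scale-⊕ : ∀ c p q → scale c (p ⊕ q) ≈ scale c p ⊕ scale c q
scale-⊕ c p q = mk≈ λ j → begin
  coeff (scale c (p ⊕ q)) j           ≡⟨ trans (coeff-scale c (p ⊕ q) j) (cong (c *_) (coeff-⊕ p q j)) ⟩
  c * (coeff p j + coeff q j)         ≡⟨ ℤP.*-distribˡ-+ c (coeff p j) _ ⟩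
  c * coeff p j + c * coeff q j       ≡⟨ sym (trans (coeff-⊕ (scale c p) (scale c q) j)
                                              (cong₂ _+_ (coeff-scale c p j) (coeff-scale c q j))) ⟩
  coeff (scale c p ⊕ scale c q) j     ∎
  where open ≡-Reasoning

scale-comm : ∀ c d p → scale c (scale d p) ≈ scale d (scale c p)
scale-comm c d p = mk≈ λ j → begin
  coeff (scale c (scale d p)) j  ≡⟨ trans (coeff-scale c (scale d p) j) (cong (c *_) (coeff-scale d p j)) ⟩
  c * (d * coeff p j)            ≡⟨ swap c d (coeff p j) ⟩
  d * (c * coeff p j)            ≡⟨ sym (trans (coeff-scale d (scale c p) j) (cong (d *_) (coeff-scale c p j))) ⟩
  coeff (scale d (scale c p)) j  ∎
  where
  open ≡-Reasoning
  swap : ∀ c d x → c * (d * x) ≡ d * (c * x)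
  swap = solve-∀

scale-one : ∀ p → scale (+ 1) p ≈ p
scale-one p = mk≈ λ j → trans (coeff-scale (+ 1) p j) (ℤP.*-identityˡ _)

scale-zero : ∀ p → scale (+ 0) p ≈ []
scale-zero p = mk≈ (coeff-scale (+ 0) p)

scale-neg : ∀ c p → scale (- c) p ≈ scale (- + 1) (scale c p)
scale-neg c p = mk≈ λ j →
  trans (coeff-scale (- c) p j)
    (trans (neg c (coeff p j)) (sym (trans (coeff-scale (- + 1) (scale c p) j) (cong (- + 1 *_) (coeff-scale c p j)))))
  where
  neg : ∀ c x → - c * x ≡ - + 1 * (c * x)
  neg = solve-∀

scale-cons : ∀ c p → scale c (+ 0 ∷ p) ≈ + 0 ∷ scale c p
scale-cons c p = ∷-cong (ℤP.*-zeroʳ c) ≈-refl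

neg-cancel : ∀ p q → p ⊕ scale (- + 1) (p ⊕ scale (- + 1) q) ≈ q
neg-cancel p q = mk≈ λ j →
  trans (coeff-⊕-scale (- + 1) p (p ⊕ scale (- + 1) q) j)
    (trans (cong (λ z → coeff p j + - + 1 * z) (coeff-⊕-scale (- + 1) p q j)) (cancel (coeff p j) (coeff q j)))
  where
  cancel : ∀ x y → x + - + 1 * (x + - + 1 * y) ≡ y
  cancel = solve-∀

coeff-⊗-[] : ∀ p j → coeff (p ⊗ []) j ≡ + 0
coeff-⊗-[] [] j = refl
coeff-⊗-[] (a ∷ p) zero = refl
coeff-⊗-[] (a ∷ p) (suc j) = coeff-⊗-[] p j

⊗-zeroʳ : ∀ p → p ⊗ [] ≈ []
⊗-zeroʳ p = mk≈ (coeff-⊗-[] p)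

⊗-congʳ : ∀ p {q q′} → q ≈ q′ → p ⊗ q ≈ p ⊗ q′
⊗-congʳ [] q≈q′ = ≈-refl
⊗-congʳ (a ∷ p) q≈q′ = ⊕-cong (scale-cong a q≈q′) (∷-cong refl (⊗-congʳ p q≈q′))

⊗-distribˡ : ∀ p q q′ → p ⊗ (q ⊕ q′) ≈ p ⊗ q ⊕ p ⊗ q′
⊗-distribˡ [] q q′ = ≈-refl
⊗-distribˡ (a ∷ p) q q′ = begin
  scale a (q ⊕ q′) ⊕ (+ 0 ∷ p ⊗ (q ⊕ q′))
    ≈⟨ ⊕-cong (scale-⊕ a q q′) (∷-cong (sym (ℤP.+-identityʳ (+ 0))) (⊗-distribˡ p q q′)) ⟩
  (scale a q ⊕ scale a q′) ⊕ ((+ 0 ∷ p ⊗ q) ⊕ (+ 0 ∷ p ⊗ q′))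
    ≈⟨ ⊕-interchange (scale a q) (scale a q′) (+ 0 ∷ p ⊗ q) (+ 0 ∷ p ⊗ q′) ⟩
  (scale a q ⊕ (+ 0 ∷ p ⊗ q)) ⊕ (scale a q′ ⊕ (+ 0 ∷ p ⊗ q′)) ∎
  where open ≈-Reasoning

⊗-scaleʳ : ∀ c p q → p ⊗ scale c q ≈ scale c (p ⊗ q)
⊗-scaleʳ c [] q = ≈-refl
⊗-scaleʳ c (a ∷ p) q = begin
  scale a (scale c q) ⊕ (+ 0 ∷ p ⊗ scale c q)  ≈⟨ ⊕-cong (scale-comm a c q) (∷-cong refl (⊗-scaleʳ c p q)) ⟩
  scale c (scale a q) ⊕ (+ 0 ∷ scale c (p ⊗ q)) ≈⟨ ⊕-cong ≈-refl (≈-sym (scale-cons c (p ⊗ q))) ⟩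
  scale c (scale a q) ⊕ scale c (+ 0 ∷ p ⊗ q)   ≈⟨ ≈-sym (scale-⊕ c (scale a q) (+ 0 ∷ p ⊗ q)) ⟩
  scale c (scale a q ⊕ (+ 0 ∷ p ⊗ q))           ∎
  where open ≈-Reasoning

⊗-consʳ : ∀ p q → p ⊗ (+ 0 ∷ q) ≈ + 0 ∷ p ⊗ q
⊗-consʳ [] q = ≈-sym 0∷[]≈[]
⊗-consʳ (a ∷ p) q = begin
  scale a (+ 0 ∷ q) ⊕ (+ 0 ∷ p ⊗ (+ 0 ∷ q)) ≈⟨ ⊕-cong (scale-cons a q) (∷-cong refl (⊗-consʳ p q)) ⟩
  (+ 0 ∷ scale a q) ⊕ (+ 0 ∷ + 0 ∷ p ⊗ q)    ≈⟨ ∷-cong (ℤP.+-identityʳ (+ 0)) ≈-refl ⟩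
  + 0 ∷ (scale a q ⊕ (+ 0 ∷ p ⊗ q))          ∎
  where open ≈-Reasoning

⊗-singletonʳ : ∀ p a → p ⊗ (a ∷ []) ≈ scale a p
⊗-singletonʳ [] a = ≈-refl
⊗-singletonʳ (b ∷ p) a = ∷-cong (trans (ℤP.+-identityʳ (b * a)) (ℤP.*-comm b a)) (⊗-singletonʳ p a)

∷-split : ∀ a p → a ∷ p ≈ (a ∷ []) ⊕ (+ 0 ∷ p)
∷-split a p = ∷-cong (sym (ℤP.+-identityʳ a)) ≈-refl

⊗-comm : ∀ p q → p ⊗ q ≈ q ⊗ p
⊗-comm [] q = ≈-sym (⊗-zeroʳ q)
⊗-comm (a ∷ p) q = begin
  scale a q ⊕ (+ 0 ∷ p ⊗ q)     ≈⟨ ⊕-cong (≈-sym (⊗-singletonʳ q a)) (∷-cong refl (⊗-comm p q)) ⟩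
  q ⊗ (a ∷ []) ⊕ (+ 0 ∷ q ⊗ p)  ≈⟨ ⊕-cong ≈-refl (≈-sym (⊗-consʳ q p)) ⟩
  q ⊗ (a ∷ []) ⊕ q ⊗ (+ 0 ∷ p)  ≈⟨ ≈-sym (⊗-distribˡ q (a ∷ []) (+ 0 ∷ p)) ⟩
  q ⊗ ((a ∷ []) ⊕ (+ 0 ∷ p))    ≈⟨ ⊗-congʳ q (≈-sym (∷-split a p)) ⟩
  q ⊗ (a ∷ p)                   ∎
  where open ≈-Reasoning

⊗-congˡ : ∀ {p p′} q → p ≈ p′ → p ⊗ q ≈ p′ ⊗ q
⊗-congˡ {p} {p′} q p≈p′ = ≈-trans (⊗-comm p q) (≈-trans (⊗-congʳ q p≈p′) (⊗-comm q p′))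

⊗-cong : ∀ {p p′ q q′} → p ≈ p′ → q ≈ q′ → p ⊗ q ≈ p′ ⊗ q′
⊗-cong {p′ = p′} {q = q} p≈p′ q≈q′ = ≈-trans (⊗-congˡ q p≈p′) (⊗-congʳ p′ q≈q′)

⊗-distribʳ : ∀ p p′ q → (p ⊕ p′) ⊗ q ≈ p ⊗ q ⊕ p′ ⊗ q
⊗-distribʳ p p′ q = ≈-trans (⊗-comm (p ⊕ p′) q)
  (≈-trans (⊗-distribˡ q p p′) (⊕-cong (⊗-comm q p) (⊗-comm q p′)))

⊗-scaleˡ : ∀ c p q → scale c p ⊗ q ≈ scale c (p ⊗ q)
⊗-scaleˡ c p q = ≈-trans (⊗-comm (scale c p) q) (≈-trans (⊗-scaleʳ c q p) (scale-cong c (⊗-comm q p)))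

⊗-assoc : ∀ p q r → (p ⊗ q) ⊗ r ≈ p ⊗ (q ⊗ r)
⊗-assoc [] q r = ≈-refl
⊗-assoc (a ∷ p) q r = begin
  (scale a q ⊕ (+ 0 ∷ p ⊗ q)) ⊗ r           ≈⟨ ⊗-distribʳ (scale a q) (+ 0 ∷ p ⊗ q) r ⟩
  scale a q ⊗ r ⊕ (+ 0 ∷ p ⊗ q) ⊗ r         ≈⟨ ⊕-cong (⊗-scaleˡ a q r) (⊕-cong (scale-zero r) ≈-refl) ⟩
  scale a (q ⊗ r) ⊕ (+ 0 ∷ (p ⊗ q) ⊗ r)     ≈⟨ ⊕-cong ≈-refl (∷-cong refl (⊗-assoc p q r)) ⟩
  scale a (q ⊗ r) ⊕ (+ 0 ∷ p ⊗ (q ⊗ r))     ∎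
  where open ≈-Reasoning

⊗-commutativeSemigroup : CommutativeSemigroup 0ℓ 0ℓ
⊗-commutativeSemigroup = record
  { _≈_ = _≈_
  ; _∙_ = _⊗_
  ; isCommutativeSemigroup = record
    { isSemigroup = record
      { isMagma = record { isEquivalence = ≈-isEquivalence ; ∙-cong = ⊗-cong }
      ; assoc = ⊗-assoc
      }
    ; comm = ⊗-comm
    }
  }

open CommutativeSemigroupProperties ⊗-commutativeSemigroup using () renaming (x∙yz≈y∙xz to ⊗-leftComm)

sumFin-cong : ∀ n {f g : Fin n → Poly} → (∀ i → f i ≈ g i) → sumFin n f ≈ sumFin n g
sumFin-cong zero f≈g = ≈-refl
sumFin-cong (suc n) f≈g = ⊕-cong (f≈g zero) (sumFin-cong n (f≈g ∘ suc))

sumFin-zero : ∀ n (f : Fin n → Poly) → (∀ i → f i ≈ []) → sumFin n f ≈ []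
sumFin-zero zero f f≈0 = ≈-refl
sumFin-zero (suc n) f f≈0 = ⊕-cong (f≈0 zero) (sumFin-zero n (f ∘ suc) (f≈0 ∘ suc))

sumFin-⊕ : ∀ n (f g : Fin n → Poly) → sumFin n (λ i → f i ⊕ g i) ≈ sumFin n f ⊕ sumFin n g
sumFin-⊕ zero f g = ≈-refl
sumFin-⊕ (suc n) f g = ≈-trans (⊕-cong ≈-refl (sumFin-⊕ n (f ∘ suc) (g ∘ suc)))
  (⊕-interchange (f zero) (g zero) (sumFin n (f ∘ suc)) (sumFin n (g ∘ suc)))

sumFin-scale : ∀ n c (f : Fin n → Poly) → sumFin n (λ i → scale c (f i)) ≈ scale c (sumFin n f)
sumFin-scale zero c f = ≈-refl
sumFin-scale (suc n) c f = ≈-trans (⊕-cong ≈-refl (sumFin-scale n c (f ∘ suc)))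
  (≈-sym (scale-⊕ c (f zero) (sumFin n (f ∘ suc))))

⊗-sumFin : ∀ n a (f : Fin n → Poly) → a ⊗ sumFin n f ≈ sumFin n (λ i → a ⊗ f i)
⊗-sumFin zero a f = ⊗-zeroʳ a
⊗-sumFin (suc n) a f = ≈-trans (⊗-distribˡ a (f zero) (sumFin n (f ∘ suc)))
  (⊕-cong ≈-refl (⊗-sumFin n a (f ∘ suc)))

-- det (suc n) M unfolds definitionally to expand (suc n) (M zero) (its minors).
expand : ∀ n → (Fin n → Poly) → (Fin n → Poly) → Poly
expand n u D = sumFin n (λ j → scale (negOnePow (toℕ j)) (u j ⊗ D j))

expand-cong : ∀ n {u u′ D D′ : Fin n → Poly} → (∀ j → u j ≈ u′ j) → (∀ j → D j ≈ D′ j) →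
              expand n u D ≈ expand n u′ D′
expand-cong n u≈u′ D≈D′ = sumFin-cong n λ j → scale-cong _ (⊗-cong (u≈u′ j) (D≈D′ j))

expand-congʳ : ∀ n u {D D′ : Fin n → Poly} → (∀ j → D j ≈ D′ j) → expand n u D ≈ expand n u D′
expand-congʳ n u D≈D′ = expand-cong n {u} {u} (λ _ → ≈-refl) D≈D′

expand-comm : ∀ n (u D : Fin n → Poly) → expand n u D ≈ expand n D u
expand-comm n u D = sumFin-cong n λ j → scale-cong _ (⊗-comm (u j) (D j))

expand-linearˡ : ∀ n c (x y D : Fin n → Poly) →
                 expand n (λ j → x j ⊕ scale c (y j)) D ≈ expand n x D ⊕ scale c (expand n y D)
expand-linearˡ n c x y D = begin
  expand n (λ j → x j ⊕ scale c (y j)) D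
    ≈⟨ sumFin-cong n term ⟩
  sumFin n (λ j → scale (s j) (x j ⊗ D j) ⊕ scale c (scale (s j) (y j ⊗ D j)))
    ≈⟨ sumFin-⊕ n (λ j → scale (s j) (x j ⊗ D j)) (λ j → scale c (scale (s j) (y j ⊗ D j))) ⟩
  expand n x D ⊕ sumFin n (λ j → scale c (scale (s j) (y j ⊗ D j)))
    ≈⟨ ⊕-cong ≈-refl (sumFin-scale n c λ j → scale (s j) (y j ⊗ D j)) ⟩
  expand n x D ⊕ scale c (expand n y D) ∎
  where
  open ≈-Reasoning
  s : Fin n → ℤ
  s j = negOnePow (toℕ j)
  term : ∀ j → scale (s j) ((x j ⊕ scale c (y j)) ⊗ D j) ≈
               scale (s j) (x j ⊗ D j) ⊕ scale c (scale (s j) (y j ⊗ D j))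
  term j = begin
    scale (s j) ((x j ⊕ scale c (y j)) ⊗ D j)
      ≈⟨ scale-cong (s j) (≈-trans (⊗-distribʳ (x j) (scale c (y j)) (D j))
                                    (⊕-cong ≈-refl (⊗-scaleˡ c (y j) (D j)))) ⟩
    scale (s j) (x j ⊗ D j ⊕ scale c (y j ⊗ D j))
      ≈⟨ scale-⊕ (s j) (x j ⊗ D j) (scale c (y j ⊗ D j)) ⟩
    scale (s j) (x j ⊗ D j) ⊕ scale (s j) (scale c (y j ⊗ D j))
      ≈⟨ ⊕-cong ≈-refl (scale-comm (s j) c (y j ⊗ D j)) ⟩
    scale (s j) (x j ⊗ D j) ⊕ scale c (scale (s j) (y j ⊗ D j)) ∎

expand-linearʳ : ∀ n c (u x y : Fin n → Poly) →
                 expand n u (λ j → x j ⊕ scale c (y j)) ≈ expand n u x ⊕ scale c (expand n u y)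
expand-linearʳ n c u x y = begin
  expand n u (λ j → x j ⊕ scale c (y j))  ≈⟨ expand-comm n u _ ⟩
  expand n (λ j → x j ⊕ scale c (y j)) u  ≈⟨ expand-linearˡ n c x y u ⟩
  expand n x u ⊕ scale c (expand n y u)   ≈⟨ ⊕-cong (expand-comm n x u) (scale-cong c (expand-comm n y u)) ⟩
  expand n u x ⊕ scale c (expand n u y)   ∎
  where open ≈-Reasoning

⊗-expand : ∀ n a (u D : Fin n → Poly) → a ⊗ expand n u D ≈ expand n u (λ j → a ⊗ D j)
⊗-expand n a u D = ≈-trans (⊗-sumFin n a _) (sumFin-cong n λ j →
  ≈-trans (⊗-scaleʳ _ a (u j ⊗ D j)) (scale-cong _ (⊗-leftComm a (u j) (D j))))

expand-suc : ∀ n (u D : Fin (suc n) → Poly) →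
             expand (suc n) u D ≈ u zero ⊗ D zero ⊕ scale (- + 1) (expand n (u ∘ suc) (D ∘ suc))
expand-suc n u D = ⊕-cong (scale-one _)
  (≈-trans (sumFin-cong n λ j → scale-neg _ _) (sumFin-scale n (- + 1) _))

det-cong : ∀ n {M N : Fin n → Fin n → Poly} → (∀ i j → M i j ≈ N i j) → det n M ≈ det n N
det-cong zero M≈N = ≈-refl
det-cong (suc n) M≈N =
  expand-cong (suc n) (M≈N zero) λ j → det-cong n λ a b → M≈N (suc a) (punchIn j b)

-- Expansion along the first two rows u and w; G gives the minor of the remaining rows
-- for each choice of the remaining columns.
expand² : ∀ {m} (u w : Fin (suc (suc m)) → Poly) → ((Fin m → Fin (suc (suc m))) → Poly) → Poly
expand² {m} u w G =
  expand (suc (suc m)) u λ j → expand (suc m) (w ∘ punchIn j) λ k → G (punchIn j ∘ punchIn k)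

-- The terms with column 0 in one of the two equal rows cancel in pairs.
expand²-peel : ∀ m (u : Fin (suc (suc m)) → Poly) (G : (Fin m → Fin (suc (suc m))) → Poly) →
               expand² u u G ≈
               expand (suc m) (u ∘ suc) λ j →
                 expand m (u ∘ suc ∘ punchIn j) λ k → G (punchIn (suc j) ∘ punchIn (suc k))
expand²-peel m u G = begin
  expand² u u G
    ≈⟨ expand-suc (suc m) u minor ⟩
  u zero ⊗ expand (suc m) (u ∘ suc) g ⊕ scale (- + 1) (expand (suc m) (u ∘ suc) (minor ∘ suc))
    ≈⟨ ⊕-cong (⊗-expand (suc m) (u zero) (u ∘ suc) g)
              (scale-cong (- + 1) (expand-cong (suc m) {u ∘ suc} {u ∘ suc} {minor ∘ suc} (λ _ → ≈-refl) λ j →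
                 expand-suc m (u ∘ punchIn (suc j)) λ k → G (punchIn (suc j) ∘ punchIn k))) ⟩
  Z ⊕ scale (- + 1) (expand (suc m) (u ∘ suc) λ j → u zero ⊗ g j ⊕ scale (- + 1) (X j))
    ≈⟨ ⊕-cong ≈-refl (scale-cong (- + 1) (expand-linearʳ (suc m) (- + 1) (u ∘ suc) (λ j → u zero ⊗ g j) X)) ⟩
  Z ⊕ scale (- + 1) (Z ⊕ scale (- + 1) (expand (suc m) (u ∘ suc) X))
    ≈⟨ neg-cancel Z (expand (suc m) (u ∘ suc) X) ⟩
  expand (suc m) (u ∘ suc) X ∎
  where
  open ≈-Reasoning
  g : Fin (suc m) → Poly
  g j = G (suc ∘ punchIn j)
  minor : Fin (suc (suc m)) → Poly
  minor j = expand (suc m) (u ∘ punchIn j) λ k → G (punchIn j ∘ punchIn k)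
  X : Fin (suc m) → Poly
  X j = expand m (u ∘ suc ∘ punchIn j) λ k → G (punchIn (suc j) ∘ punchIn (suc k))
  Z : Poly
  Z = expand (suc m) (u ∘ suc) λ j → u zero ⊗ g j

expand²-repeated : ∀ m (u : Fin (suc (suc m)) → Poly) (G : (Fin m → Fin (suc (suc m))) → Poly) →
                   (∀ {h h′} → h ≗ h′ → G h ≈ G h′) → expand² u u G ≈ []
expand²-repeated zero u G G-resp =
  ≈-trans (expand²-peel zero u G)
          (sumFin-zero 1 (λ j → scale (+ 1) (u (suc j) ⊗ [])) λ j → scale-cong (+ 1) (⊗-zeroʳ (u (suc j))))
expand²-repeated (suc m) u G G-resp = begin
  expand² u u G
    ≈⟨ expand²-peel (suc m) u G ⟩
  (expand (suc (suc m)) (u ∘ suc) λ j →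
     expand (suc m) (u ∘ suc ∘ punchIn j) λ k → G (punchIn (suc j) ∘ punchIn (suc k)))
    ≈⟨ expand-congʳ (suc (suc m)) (u ∘ suc) (λ j →
         expand-congʳ (suc m) (u ∘ suc ∘ punchIn j) λ k → G-resp (lifted j k)) ⟩
  expand² (u ∘ suc) (u ∘ suc) (G ∘ lift 1)
    ≈⟨ expand²-repeated m (u ∘ suc) (G ∘ lift 1) (λ h≗h′ → G-resp (lift-cong h≗h′)) ⟩
  [] ∎
  where
  open ≈-Reasoning
  lifted : ∀ j k → punchIn (suc j) ∘ punchIn (suc k) ≗ lift 1 (punchIn j ∘ punchIn k)
  lifted j k zero = refl
  lifted j k (suc b) = refl
  lift-cong : ∀ {h h′ : Fin m → Fin (suc (suc m))} → h ≗ h′ → lift 1 h ≗ lift 1 h′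
  lift-cong h≗h′ zero = refl
  lift-cong h≗h′ (suc b) = cong suc (h≗h′ b)

-- Matrices with rows indexed by ℕ, so that row arithmetic is ordinary arithmetic.
Rows : ℕ → Set
Rows n = ℕ → Fin n → Poly

detR : ∀ n → Rows n → Poly
detR n R = det n λ i j → R (toℕ i) j

minorR : ∀ {n} → Rows (suc n) → Fin (suc n) → Rows n
minorR R j k b = R (suc k) (punchIn j b)

replaceRow₀ : ∀ {n} → (Fin n → Poly) → Rows n → Rows n
replaceRow₀ x R zero = x
replaceRow₀ x R (suc k) = R (suc k)

detR-cong : ∀ n {R R′ : Rows n} → (∀ k → k < n → ∀ j → R k j ≈ R′ k j) → detR n R ≈ detR n R′
detR-cong n R≈R′ = det-cong n λ i j → R≈R′ (toℕ i) (toℕ<n i) j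

detR-addPrevious : ∀ n a c (R R′ : Rows n) →
                   (∀ k → k ≤ a → ∀ j → R′ k j ≈ R k j) →
                   (∀ d j → R′ (suc (a ℕ.+ d)) j ≈ R (suc (a ℕ.+ d)) j ⊕ scale c (R (a ℕ.+ d) j)) →
                   detR n R′ ≈ detR n R
detR-addPrevious zero a c R R′ low high = ≈-refl
detR-addPrevious (suc n) (suc a) c R R′ low high =
  expand-cong (suc n) {D = λ j → detR n (minorR R′ j)} {D′ = λ j → detR n (minorR R j)} (low 0 z≤n) λ j →
    detR-addPrevious n a c (minorR R j) (minorR R′ j)
      (λ k k≤a b → low (suc k) (s≤s k≤a) (punchIn j b)) (λ d b → high d (punchIn j b))
detR-addPrevious (suc zero) zero c R R′ low high =
  expand-cong 1 {D = λ _ → + 1 ∷ []} {D′ = λ _ → + 1 ∷ []} (low 0 z≤n) λ _ → ≈-refl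
detR-addPrevious (suc (suc m)) zero c R R′ low high = begin
  detR (suc (suc m)) R′
    -- the recursive call stays in this clause, outside minor≈, for the termination checker
    ≈⟨ expand-cong (suc (suc m)) {D = λ j → detR (suc m) (minorR R′ j)} (low 0 z≤n) (λ j → minor≈ j
         (detR-addPrevious (suc m) 0 c (minorR R j) (replaceRow₀ (R 1 ∘ punchIn j) (minorR R′ j))
            (λ { zero _ b → ≈-refl ; (suc k) () }) (λ d b → high (suc d) (punchIn j b)))) ⟩
  expand (suc (suc m)) (R 0) (λ j → detR (suc m) (minorR R j) ⊕ scale c (F j))
    ≈⟨ expand-linearʳ (suc (suc m)) c (R 0) (λ j → detR (suc m) (minorR R j)) F ⟩
  detR (suc (suc m)) R ⊕ scale c (expand² (R 0) (R 0) G)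
    ≈⟨ ⊕-cong ≈-refl (scale-cong c (expand²-repeated m (R 0) G G-resp)) ⟩
  detR (suc (suc m)) R ⊕ []
    ≈⟨ ⊕-identityʳ (detR (suc (suc m)) R) ⟩
  detR (suc (suc m)) R ∎
  where
  open ≈-Reasoning
  G : (Fin m → Fin (suc (suc m))) → Poly
  G h = det m λ a b → R′ (suc (suc (toℕ a))) (h b)
  G-resp : ∀ {h h′} → h ≗ h′ → G h ≈ G h′
  G-resp h≗h′ = det-cong m λ a b → ≡⇒≈ (cong (R′ (suc (suc (toℕ a)))) (h≗h′ b))
  F : Fin (suc (suc m)) → Poly
  F j = detR (suc m) (replaceRow₀ (R 0 ∘ punchIn j) (minorR R′ j))
  minor≈ : ∀ j → detR (suc m) (replaceRow₀ (R 1 ∘ punchIn j) (minorR R′ j)) ≈ detR (suc m) (minorR R j) →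
           detR (suc m) (minorR R′ j) ≈ detR (suc m) (minorR R j) ⊕ scale c (F j)
  minor≈ j reduced = begin
    detR (suc m) (minorR R′ j)
      ≈⟨ expand-cong (suc m) {D = D} {D′ = D} (λ b → high 0 (punchIn j b)) (λ _ → ≈-refl) ⟩
    expand (suc m) (λ b → R 1 (punchIn j b) ⊕ scale c (R 0 (punchIn j b))) D
      ≈⟨ expand-linearˡ (suc m) c (R 1 ∘ punchIn j) (R 0 ∘ punchIn j) D ⟩
    detR (suc m) (replaceRow₀ (R 1 ∘ punchIn j) (minorR R′ j)) ⊕ scale c (F j)
      ≈⟨ ⊕-cong reduced ≈-refl ⟩
    detR (suc m) (minorR R j) ⊕ scale c (F j) ∎
    where
    D : Fin (suc m) → Poly
    D k = detR m (minorR (minorR R′ j) k)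

-- Row reduction of a Krylov-type matrix [T^k v_j]

module RowReduction
  (T : Poly → Poly)
  (T-cong : ∀ {p q} → p ≈ q → T p ≈ T q)
  (T-linear : ∀ c p q → T (p ⊕ scale c q) ≈ T p ⊕ scale c (T q))
  (θ : ℕ → ℤ)
  where

  shifted : ℕ → Poly → Poly
  shifted zero p = p
  shifted (suc m) p = T (shifted m p) ⊕ scale (- θ m) (shifted m p)

  iterate-cong : ∀ d {p q} → p ≈ q → iterate T p d ≈ iterate T q d
  iterate-cong zero p≈q = p≈q
  iterate-cong (suc d) p≈q = iterate-cong d (T-cong p≈q)

  iterate-linear : ∀ d c p q → iterate T (p ⊕ scale c q) d ≈ iterate T p d ⊕ scale c (iterate T q d)
  iterate-linear zero c p q = ≈-refl
  iterate-linear (suc d) c p q = ≈-trans (iterate-cong d (T-linear c p q)) (iterate-linear d c (T p) (T q))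

  -- After s steps of the reduction, rows k ≤ s are shifted k and row s + d is T^d (shifted s).
  stage : ℕ → ℕ → Poly → Poly
  stage s k p = iterate T (shifted (k ⊓ s) p) (k ∸ s)

  stage-≤ : ∀ {s k} p → k ≤ s → stage s k p ≡ shifted k p
  stage-≤ p k≤s rewrite ℕP.m≤n⇒m⊓n≡m k≤s | ℕP.m≤n⇒m∸n≡0 k≤s = refl

  stage-+ : ∀ s d p → stage s (s ℕ.+ d) p ≡ iterate T (shifted s p) d
  stage-+ s d p rewrite ℕP.m≥n⇒m⊓n≡n (ℕP.m≤m+n s d) | ℕP.m+n∸m≡n s d = refl

  stage-zero : ∀ k p → stage 0 k p ≡ iterate T p k
  stage-zero k p rewrite ℕP.⊓-zeroʳ k = refl

  stage-suc : ∀ s d p →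
              stage (suc s) (suc (s ℕ.+ d)) p ≈ stage s (suc (s ℕ.+ d)) p ⊕ scale (- θ s) (stage s (s ℕ.+ d) p)
  stage-suc s d p = begin
    stage (suc s) (suc (s ℕ.+ d)) p
      ≡⟨ stage-+ (suc s) d p ⟩
    iterate T (T y ⊕ scale (- θ s) y) d
      ≈⟨ iterate-linear d (- θ s) (T y) y ⟩
    iterate T y (suc d) ⊕ scale (- θ s) (iterate T y d)
      ≡⟨ cong₂ (λ a b → a ⊕ scale (- θ s) b) (sym below) (sym (stage-+ s d p)) ⟩
    stage s (suc (s ℕ.+ d)) p ⊕ scale (- θ s) (stage s (s ℕ.+ d) p) ∎
    where
    open ≈-Reasoning
    y : Poly
    y = shifted s p
    below : stage s (suc (s ℕ.+ d)) p ≡ iterate T y (suc d)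
    below = trans (cong (λ k → stage s k p) (sym (ℕP.+-suc s d))) (stage-+ s (suc d) p)

  detR-stage : ∀ n s (v : Fin n → Poly) →
               detR n (λ k j → stage s k (v j)) ≈ detR n (λ k j → iterate T (v j) k)
  detR-stage n zero v = detR-cong n λ k _ j → ≡⇒≈ (stage-zero k (v j))
  detR-stage n (suc s) v = ≈-trans
    (detR-addPrevious n s (- θ s) _ _
      (λ k k≤s j → ≡⇒≈ (trans (stage-≤ (v j) (ℕP.m≤n⇒m≤1+n k≤s)) (sym (stage-≤ (v j) k≤s))))
      (λ d j → stage-suc s d (v j)))
    (detR-stage n s v)

  detR-iterate≈detR-shifted : ∀ n (v : Fin n → Poly) →
                              detR n (λ k j → iterate T (v j) k) ≈ detR n (λ k j → shifted k (v j))
  detR-iterate≈detR-shifted n v = ≈-trans (≈-sym (detR-stage n n v))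
    (detR-cong n λ k k<n j → ≡⇒≈ (stage-≤ (v j) (ℕP.<⇒≤ k<n)))

-- Divisibility by powers of y

infix 4 y^_∣_

y^_∣_ : ℕ → Poly → Set
y^ m ∣ p = ∀ j → j < m → coeff p j ≡ + 0

y^∣-≈ : ∀ {m p q} → p ≈ q → y^ m ∣ p → y^ m ∣ q
y^∣-≈ p≈q y^m∣p j j<m = trans (sym (coeff-≡ p≈q j)) (y^m∣p j j<m)

y^∣-⊕ : ∀ {m} p q → y^ m ∣ p → y^ m ∣ q → y^ m ∣ p ⊕ q
y^∣-⊕ p q y^m∣p y^m∣q j j<m = trans (coeff-⊕ p q j) (cong₂ _+_ (y^m∣p j j<m) (y^m∣q j j<m))

y^∣-scale : ∀ {m} c p → y^ m ∣ p → y^ m ∣ scale c p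
y^∣-scale c p y^m∣p j j<m = trans (coeff-scale c p j) (trans (cong (c *_) (y^m∣p j j<m)) (ℤP.*-zeroʳ c))

y^∣-shift : ∀ {m p} → y^ m ∣ p → y^ suc m ∣ + 0 ∷ p
y^∣-shift y^m∣p zero _ = refl
y^∣-shift y^m∣p (suc j) (s≤s j<m) = y^m∣p j j<m

y^∣-weaken : ∀ {m p} → y^ suc m ∣ p → y^ m ∣ p
y^∣-weaken y^m∣p j j<m = y^m∣p j (ℕP.m≤n⇒m≤1+n j<m)

y^∣-⊗ : ∀ a b p q → y^ a ∣ p → y^ b ∣ q → y^ (a ℕ.+ b) ∣ p ⊗ q
y^∣-⊗ a b [] q y^a∣p y^b∣q j _ = refl
y^∣-⊗ zero b (x ∷ p) q y^a∣p y^b∣q =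
  y^∣-⊕ (scale x q) (+ 0 ∷ p ⊗ q) (y^∣-scale x q y^b∣q)
    (y^∣-weaken {p = + 0 ∷ p ⊗ q} (y^∣-shift (y^∣-⊗ zero b p q (λ _ ()) y^b∣q)))
y^∣-⊗ (suc a) b (x ∷ p) q y^a∣p y^b∣q = y^∣-⊕ (scale x q) (+ 0 ∷ p ⊗ q) x·q
  (y^∣-shift (y^∣-⊗ a b p q (λ j j<a → y^a∣p (suc j) (s≤s j<a)) y^b∣q))
  where
  x·q : y^ suc a ℕ.+ b ∣ scale x q
  x·q j _ = trans (coeff-scale x q j) (cong (_* coeff q j) (y^a∣p 0 (s≤s z≤n)))

y^∣-sumFin : ∀ {m} n (f : Fin n → Poly) → (∀ i → y^ m ∣ f i) → y^ m ∣ sumFin n f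
y^∣-sumFin zero f y^m∣f j _ = refl
y^∣-sumFin (suc n) f y^m∣f = y^∣-⊕ (f zero) _ (y^m∣f zero) (y^∣-sumFin n (f ∘ suc) (y^m∣f ∘ suc))

y^∣-det : ∀ n (M : Fin n → Fin n → Poly) (w : Fin n → ℕ) → (∀ i j → y^ w i ∣ M i j) → y^ sum w ∣ det n M
y^∣-det zero M w y^w∣M j ()
y^∣-det (suc n) M w y^w∣M = y^∣-sumFin (suc n) (λ j → scale (s j) (M zero j ⊗ minor j)) λ j →
  y^∣-scale (s j) (M zero j ⊗ minor j) (y^∣-⊗ (w zero) (sum (w ∘ suc)) (M zero j) (minor j) (y^w∣M zero j)
    (y^∣-det n (λ a b → M (suc a) (punchIn j b)) (w ∘ suc) λ a b → y^w∣M (suc a) (punchIn j b)))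
  where
  s : Fin (suc n) → ℤ
  s j = negOnePow (toℕ j)
  minor : Fin (suc n) → Poly
  minor j = det n λ a b → M (suc a) (punchIn j b)

sum-suc : ∀ n (w : Fin n → ℕ) → sum (λ i → suc (w i)) ≡ n ℕ.+ sum w
sum-suc zero w = refl
sum-suc (suc n) w = trans (cong (suc (w zero) ℕ.+_) (sum-suc n (w ∘ suc))) (shuffle (w zero) n (sum (w ∘ suc)))
  where
  shuffle : ∀ x n s → suc x ℕ.+ (n ℕ.+ s) ≡ suc n ℕ.+ (x ℕ.+ s)
  shuffle = ℕSolver.solve-∀

sum-toℕ : ∀ n → sum (toℕ {suc n}) ℕ.* 2 ≡ suc n ℕ.* n
sum-toℕ zero = refl
sum-toℕ (suc n) = begin
  sum (toℕ {suc (suc n)}) ℕ.* 2         ≡⟨ cong (ℕ._* 2) (sum-suc (suc n) toℕ) ⟩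
  (suc n ℕ.+ sum (toℕ {suc n})) ℕ.* 2   ≡⟨ ℕP.*-distribʳ-+ 2 (suc n) _ ⟩
  suc n ℕ.* 2 ℕ.+ sum (toℕ {suc n}) ℕ.* 2 ≡⟨ cong (suc n ℕ.* 2 ℕ.+_) (sum-toℕ n) ⟩
  suc n ℕ.* 2 ℕ.+ suc n ℕ.* n           ≡⟨ square n ⟩
  suc (suc n) ℕ.* suc n                 ∎
  where
  open ≡-Reasoning
  square : ∀ n → suc n ℕ.* 2 ℕ.+ suc n ℕ.* n ≡ suc (suc n) ℕ.* suc n
  square = ℕSolver.solve-∀

μ≡sum-toℕ : ∀ r → μ r ≡ sum (toℕ {r})
μ≡sum-toℕ zero = refl
μ≡sum-toℕ (suc n) = trans (cong (ℕ._/ 2) (sym (sum-toℕ n))) (m*n/n≡m (sum (toℕ {suc n})) 2)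

L : Poly → Poly
L p = (+ 0 ∷ + 4 ∷ []) ⊗ deriv p ⊕ (+ 5 ∷ - (+ 4) ∷ []) ⊗ p

P-iterate : ∀ k j → iterate L (P j) k ≡ P (k ℕ.+ j)
P-iterate zero j = refl
P-iterate (suc k) j = trans (P-iterate k (suc j)) (cong P (ℕP.+-suc k j))

L-diag : ℕ → ℤ
L-diag j = + 4 * + j + + 5

coeff-derivAux : ∀ k p j → coeff (derivAux k p) j ≡ + (k ℕ.+ j) * coeff p j
coeff-derivAux k [] j = sym (ℤP.*-zeroʳ (+ (k ℕ.+ j)))
coeff-derivAux k (b ∷ p) zero = cong (λ n → + n * b) (sym (ℕP.+-identityʳ k))
coeff-derivAux k (b ∷ p) (suc j) =
  trans (coeff-derivAux (suc k) p j) (cong (λ n → + n * coeff p j) (sym (ℕP.+-suc k j)))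

coeff-y·deriv : ∀ p j → coeff (+ 0 ∷ deriv p) j ≡ + j * coeff p j
coeff-y·deriv p zero = refl
coeff-y·deriv [] (suc j) = sym (ℤP.*-zeroʳ (+ suc j))
coeff-y·deriv (a ∷ p) (suc j) = coeff-derivAux 1 p j

coeff-linear⊗ : ∀ a b q j → coeff ((a ∷ b ∷ []) ⊗ q) j ≡ a * coeff q j + b * coeff (+ 0 ∷ q) j
coeff-linear⊗ a b q zero =
  trans (coeff-⊕ (scale a q) _ 0) (cong₂ _+_ (coeff-scale a q 0) (sym (ℤP.*-zeroʳ b)))
coeff-linear⊗ a b q (suc j) = trans (coeff-⊕ (scale a q) _ (suc j)) (cong₂ _+_ (coeff-scale a q (suc j))
  (trans (coeff-⊕ (scale b q) _ j)
         (trans (cong₂ _+_ (coeff-scale b q j) (coeff-≡ 0∷[]≈[] j)) (ℤP.+-identityʳ _))))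

coeff-L : ∀ p j → coeff (L p) j ≡ L-diag j * coeff p j - + 4 * coeff (+ 0 ∷ p) j
coeff-L p j = begin
  coeff (L p) j
    ≡⟨ trans (coeff-⊕ ((+ 0 ∷ + 4 ∷ []) ⊗ deriv p) ((+ 5 ∷ - (+ 4) ∷ []) ⊗ p) j)
             (cong₂ _+_ (coeff-linear⊗ (+ 0) (+ 4) (deriv p) j) (coeff-linear⊗ (+ 5) (- (+ 4)) p j)) ⟩
  + 0 * coeff (deriv p) j + + 4 * coeff (+ 0 ∷ deriv p) j + (+ 5 * coeff p j + - (+ 4) * coeff (+ 0 ∷ p) j)
    ≡⟨ cong (λ e → + 0 * coeff (deriv p) j + + 4 * e + (+ 5 * coeff p j + - (+ 4) * coeff (+ 0 ∷ p) j))
            (coeff-y·deriv p j) ⟩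
  + 0 * coeff (deriv p) j + + 4 * (+ j * coeff p j) + (+ 5 * coeff p j + - (+ 4) * coeff (+ 0 ∷ p) j)
    ≡⟨ collect (coeff (deriv p) j) (+ j) (coeff p j) (coeff (+ 0 ∷ p) j) ⟩
  L-diag j * coeff p j - + 4 * coeff (+ 0 ∷ p) j ∎
  where
  open ≡-Reasoning
  collect : ∀ d n x x′ → + 0 * d + + 4 * (n * x) + (+ 5 * x + - (+ 4) * x′) ≡ (+ 4 * n + + 5) * x - + 4 * x′
  collect = solve-∀

L-cong : ∀ {p q} → p ≈ q → L p ≈ L q
L-cong {p} {q} p≈q = mk≈ λ j → trans (coeff-L p j)
  (trans (cong₂ (λ x x′ → L-diag j * x - + 4 * x′) (coeff-≡ p≈q j) (coeff-≡ (∷-cong refl p≈q) j))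
         (sym (coeff-L q j)))

L-linear : ∀ c p q → L (p ⊕ scale c q) ≈ L p ⊕ scale c (L q)
L-linear c p q = mk≈ λ j → begin
  coeff (L (p ⊕ scale c q)) j
    ≡⟨ coeff-L (p ⊕ scale c q) j ⟩
  L-diag j * coeff (p ⊕ scale c q) j - + 4 * coeff (+ 0 ∷ p ⊕ scale c q) j
    ≡⟨ cong₂ (λ x x′ → L-diag j * x - + 4 * x′) (coeff-⊕-scale c p q j) (cons-⊕-scale j) ⟩
  L-diag j * (coeff p j + c * coeff q j) - + 4 * (coeff (+ 0 ∷ p) j + c * coeff (+ 0 ∷ q) j)
    ≡⟨ regroup (L-diag j) c (coeff p j) (coeff q j) (coeff (+ 0 ∷ p) j) (coeff (+ 0 ∷ q) j) ⟩
  (L-diag j * coeff p j - + 4 * coeff (+ 0 ∷ p) j) + c * (L-diag j * coeff q j - + 4 * coeff (+ 0 ∷ q) j)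
    ≡⟨ sym (cong₂ (λ x y → x + c * y) (coeff-L p j) (coeff-L q j)) ⟩
  coeff (L p) j + c * coeff (L q) j
    ≡⟨ sym (coeff-⊕-scale c (L p) (L q) j) ⟩
  coeff (L p ⊕ scale c (L q)) j ∎
  where
  open ≡-Reasoning
  regroup : ∀ d c x y x′ y′ →
            d * (x + c * y) - + 4 * (x′ + c * y′) ≡ (d * x - + 4 * x′) + c * (d * y - + 4 * y′)
  regroup = solve-∀
  cons-⊕-scale : ∀ j → coeff (+ 0 ∷ p ⊕ scale c q) j ≡ coeff (+ 0 ∷ p) j + c * coeff (+ 0 ∷ q) j
  cons-⊕-scale zero = sym (trans (cong (λ z → + 0 + z) (ℤP.*-zeroʳ c)) (ℤP.+-identityʳ (+ 0)))
  cons-⊕-scale (suc j) = coeff-⊕-scale c p q j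

y^∣-L-shifted : ∀ m p → y^ m ∣ p → y^ suc m ∣ L p ⊕ scale (- L-diag m) p
y^∣-L-shifted m p y^m∣p j j<1+m = begin
  coeff (L p ⊕ scale (- L-diag m) p) j
    ≡⟨ coeff-⊕-scale (- L-diag m) (L p) p j ⟩
  coeff (L p) j + - L-diag m * coeff p j
    ≡⟨ cong (_+ - L-diag m * coeff p j) (coeff-L p j) ⟩
  L-diag j * coeff p j - + 4 * coeff (+ 0 ∷ p) j + - L-diag m * coeff p j
    ≡⟨ cong (λ x′ → L-diag j * coeff p j - + 4 * x′ + - L-diag m * coeff p j) (y^∣-shift y^m∣p j j<1+m) ⟩
  L-diag j * coeff p j - + 4 * + 0 + - L-diag m * coeff p j
    ≡⟨ vanish (ℕP.m≤n⇒m<n∨m≡n (ℕP.≤-pred j<1+m)) ⟩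
  + 0 ∎
  where
  open ≡-Reasoning
  vanish : j < m ⊎ j ≡ m → L-diag j * coeff p j - + 4 * + 0 + - L-diag m * coeff p j ≡ + 0
  vanish (inj₁ j<m) rewrite y^m∣p j j<m = zeros (L-diag j) (L-diag m)
    where
    zeros : ∀ a b → a * + 0 - + 4 * + 0 + - b * + 0 ≡ + 0
    zeros = solve-∀
  vanish (inj₂ refl) = diagonal (L-diag m) (coeff p j)
    where
    diagonal : ∀ a x → a * x - + 4 * + 0 + - a * x ≡ + 0
    diagonal = solve-∀

open RowReduction L L-cong L-linear L-diag

y^∣-shifted : ∀ k p → y^ k ∣ shifted k p
y^∣-shifted zero p j ()
y^∣-shifted (suc k) p = y^∣-L-shifted k (shifted k p) (y^∣-shifted k p)

-- The bound holds for every r.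
lemma6p1 : (r : ℕ) → 2 ≤ r → (j : ℕ) → j < μ r → coeff (scale (ε r) (W r)) j ≡ + 0
lemma6p1 r _ = y^∣-scale (ε r) (W r) (subst (y^_∣ W r) (sym (μ≡sum-toℕ r)) y^∣W)
  where
  W≈ : W r ≈ detR r (λ k j → shifted k (P (toℕ j)))
  W≈ = ≈-trans (det-cong r λ i j → ≡⇒≈ (sym (P-iterate (toℕ i) (toℕ j))))
               (detR-iterate≈detR-shifted r (P ∘ toℕ))
  y^∣W : y^ sum (toℕ {r}) ∣ W r
  y^∣W = y^∣-≈ (≈-sym W≈) (y^∣-det r _ toℕ λ i j → y^∣-shifted (toℕ i) (P (toℕ j)))
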